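{- For all pure $\lambda$-terms $t$ and $u$ (terms without explicit substitutions), $t$ and $u$ are observationally equivalent with respect to weak-head needed reduction $\rightarrow_{\mathtt{whnd}}$ if and only if they are observationally equivalent with respect to call-by-need reduction $\rightarrow_{\mathtt{need}}$.
   Context: Pure $\lambda$-terms: $t,u ::= x \mid t\,u \mid \lambda x.t$ (modulo $\alpha$-conversion); $\rightarrow_\beta$ is the closure under all contexts of $(\lambda x.t)u \mapsto t\{x:=u\}$. Occurrences of a term are words over $\{0,1\}$: $\mathrm{oc}(x)=\{\epsilon\}$, $\mathrm{oc}(t\,u)=\{\epsilon\}\cup 0\cdot\mathrm{oc}(t)\cup 1\cdot\mathrm{oc}(u)$, $\mathrm{oc}(\lambda x.t)=\{\epsilon\}\cup 0\cdot\mathrm{oc}(t)$; $t|_p$ is the subterm at $p$; a redex occurrence is a $p$ with $t|_p$ of the form $(\lambda x.s)v$. Descendants of an occurrence $p$ after contracting the redex at $r$ (with $t|_r=(\lambda x.s)v$): $\emptyset$ if $p=r$ or $p=r0$; $\{p\}$ if $r$ is not a prefix of $p$; $\{rq\}$ if $p=r00q$; $\{rkq \mid s|_k = x\}$ if $p=r1q$. Descendants of redex occurrences are called residuals; residuals after a reduction sequence are obtained by iterating. A redex $r$ of $t$ is used in a reduction sequence if the sequence contracts $r$ or some residual of $r$. A term is in weak-head normal form (WHNF) if it is of the form $\lambda x.t$ or $x\,t_1\cdots t_n$ ($n\ge 0$). A redex $r$ in $t$ is weak-head needed if every $\beta$-reduction sequence from $t$ to a WHNF uses $r$ (so if $t$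 has no WHNF, every redex is weak-head needed). $t\rightarrow_{\mathtt{whnd}} t'$ iff $t\rightarrow_\beta t'$ by contracting a weak-head needed redex of $t$. Call-by-need calculus: terms with explicit substitutions $t,u ::= x \mid t\,u \mid \lambda x.t \mid t[x/u]$ ($x$ bound in $t$); values $v ::= \lambda x.t$; list contexts $L ::= \square \mid L[x/t]$; need contexts $M,N ::= \square \mid N\,t \mid N[x/t] \mid N\langle\!\langle x\rangle\!\rangle[x/M]$, where $N\langle\!\langle u\rangle\!\rangle$ denotes filling $N$ with $u$ without capturing the free variables of $u$. $\rightarrow_{\mathtt{need}}$ is the union of the closures under need contexts of the rules $L[\lambda x.t]\,u \mapsto L[t[x/u]]$ and $N\langle\!\langle x\rangle\!\rangle[x/L[v]] \mapsto L[N\langle\!\langle v\rangle\!\rangle[x/v]]$ (capture-avoiding). For a reduction relation $\mathcal{R}$, a term $t$ is $\mathcal{R}$-normalising if it reduces by $\mathcal{R}$ in finitely many steps to a term with no $\mathcal{R}$-step. Terms $t,u$ are observationally equivalent w.r.t. $\mathcal{R}$ if for every context $C$ of the corresponding term language (a term with one hole; for $\rightarrow_{\mathtt{whnd}}$ pure $\lambda$-contexts, for $\rightarrow_{\mathtt{need}}$ contexts of the language with explicit substitutions), $C[t]$ is $\mathcal{R}$-normalising iff $C[u]$ is $\mathcal{R}$-normalising. -}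

module Defs where

open import Data.Nat using (ℕ; zero; suc; _+_; _∸_; _<ᵇ_; _≡ᵇ_)
open import Data.Bool using (if_then_else_)
open import Data.List using (List; []; _∷_; _++_; map; concatMap)
open import Data.List.Membership.Propositional using (_∈_)
open import Data.Maybe using (Maybe; just; nothing)
open import Data.Product using (Σ; _×_; ∃)
open import Data.Empty using (⊥)
open import Relation.Nullary using (¬_)
open import Relation.Binary.Construct.Closure.ReflexiveTransitive using (Star)
open import Function.Bundles using (_⇔_)

Normalising : {A : Set} → (A → A → Set) → A → Set
Normalising {A} R t = Σ A λ t' → Star R t t' × (∀ t'' → ¬ R t' t'')

data Λ : Set where
  pvar : ℕ → Λ
  papp : Λ → Λ → Λ
  plam : Λ → Λ

shiftΛ : ℕ → ℕ → Λ → Λ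
shiftΛ c k (pvar n) = if n <ᵇ c then pvar n else pvar (n + k)
shiftΛ c k (papp t u) = papp (shiftΛ c k t) (shiftΛ c k u)
shiftΛ c k (plam t) = plam (shiftΛ (suc c) k t)

substΛ : ℕ → Λ → Λ → Λ
substΛ j v (pvar n) =
  if n ≡ᵇ j then shiftΛ 0 j v else (if n <ᵇ j then pvar n else pvar (n ∸ 1))
substΛ j v (papp t u) = papp (substΛ j v t) (substΛ j v u)
substΛ j v (plam t) = plam (substΛ (suc j) v t)

-- t{x:=u} where x is the variable bound by the abstraction whose body is t
_[0≔_] : Λ → Λ → Λ
s [0≔ v ] = substΛ 0 v s

data Bit : Set where
  b0 b1 : Bit

Pos : Set
Pos = List Bit

subterm : Λ → Pos → Maybe Λ
subterm t [] = just t
subterm (papp t u) (b0 ∷ p) = subterm t p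
subterm (papp t u) (b1 ∷ p) = subterm u p
subterm (plam t) (b0 ∷ p) = subterm t p
subterm _ _ = nothing

data Step : Λ → Pos → Λ → Set where
  β-root : ∀ {s v} → Step (papp (plam s) v) [] (s [0≔ v ])
  β-appL : ∀ {t t' u r} → Step t r t' → Step (papp t u) (b0 ∷ r) (papp t' u)
  β-appR : ∀ {t u u' r} → Step u r u' → Step (papp t u) (b1 ∷ r) (papp t u')
  β-lam  : ∀ {t t' r} → Step t r t' → Step (plam t) (b0 ∷ r) (plam t')

_→β_ : Λ → Λ → Set
t →β t' = Σ Pos λ r → Step t r t'

boundOccs : ℕ → Λ → List Pos
boundOccs d (pvar n) = if n ≡ᵇ d then [] ∷ [] else []
boundOccs d (papp t u) = map (b0 ∷_) (boundOccs d t) ++ map (b1 ∷_) (boundOccs d u)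
boundOccs d (plam t) = map (b0 ∷_) (boundOccs (suc d) t)

bitEq : Bit → Bit → Data.Bool.Bool
bitEq b0 b0 = Data.Bool.true
bitEq b1 b1 = Data.Bool.true
bitEq _ _ = Data.Bool.false

stripPrefix : Pos → Pos → Maybe Pos
stripPrefix [] p = just p
stripPrefix (a ∷ r) [] = nothing
stripPrefix (a ∷ r) (b ∷ p) = if bitEq a b then stripPrefix r p else nothing

-- descendants of p after contracting the redex at r whose abstraction body is s
descAux : Λ → Pos → Pos → Maybe Pos → List Pos
descAux s r p nothing = p ∷ []
descAux s r p (just []) = []
descAux s r p (just (b0 ∷ [])) = []
descAux s r p (just (b0 ∷ b0 ∷ q)) = (r ++ q) ∷ []
descAux s r p (just (b0 ∷ b1 ∷ q)) = []   -- r01q is never an occurrence of t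
descAux s r p (just (b1 ∷ q)) = map (λ k → r ++ (k ++ q)) (boundOccs 0 s)

desc : Λ → Pos → Pos → List Pos
desc s r p = descAux s r p (stripPrefix r p)

residAux : Maybe Λ → Pos → List Pos → List Pos
residAux (just (papp (plam s) v)) r R = concatMap (desc s r) R
residAux _ r R = []

resid : Λ → Pos → List Pos → List Pos
resid t r R = residAux (subterm t r) r R

data Red : Λ → Λ → Set where
  done : ∀ {t} → Red t t
  step : ∀ {t r t₁ t₂} → Step t r t₁ → Red t₁ t₂ → Red t t₂

data Uses : ∀ {t t'} → Red t t' → List Pos → Set where
  now   : ∀ {t r t₁ t₂ R} {st : Step t r t₁} {red : Red t₁ t₂} →
          r ∈ R → Uses (step st red) R
  later : ∀ {t r t₁ t₂ R} {st : Step t r t₁} {red : Red t₁ t₂} →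
          Uses red (resid t r R) → Uses (step st red) R

data Neutral : Λ → Set where
  ne-var : ∀ {x} → Neutral (pvar x)
  ne-app : ∀ {t u} → Neutral t → Neutral (papp t u)

data WHNF : Λ → Set where
  whnf-lam : ∀ {t} → WHNF (plam t)
  whnf-ne  : ∀ {t} → Neutral t → WHNF t

RedexOcc : Λ → Pos → Set
RedexOcc t r = ∃ λ t' → Step t r t'

WeakHeadNeeded : Λ → Pos → Set
WeakHeadNeeded t r =
  RedexOcc t r × (∀ t' → (red : Red t t') → WHNF t' → Uses red (r ∷ []))

_→whnd_ : Λ → Λ → Set
t →whnd t' = Σ Pos λ r → Step t r t' × WeakHeadNeeded t r

-- pure λ-contexts (plugging may capture)
data PCtx : Set where
  ◻     : PCtx
  pappL : PCtx → Λ → PCtx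
  pappR : Λ → PCtx → PCtx
  plamC : PCtx → PCtx

plugP : PCtx → Λ → Λ
plugP ◻ s = s
plugP (pappL C u) s = papp (plugP C s) u
plugP (pappR t C) s = papp t (plugP C s)
plugP (plamC C) s = plam (plugP C s)

ObsEqWhnd : Λ → Λ → Set
ObsEqWhnd t u = ∀ C → Normalising _→whnd_ (plugP C t) ⇔ Normalising _→whnd_ (plugP C u)

data Tm : Set where
  var  : ℕ → Tm
  app  : Tm → Tm → Tm
  lam  : Tm → Tm
  esub : Tm → Tm → Tm   -- esub t u = t[x/u], x is index 0 in t

⌜_⌝ : Λ → Tm
⌜ pvar n ⌝ = var n
⌜ papp t u ⌝ = app ⌜ t ⌝ ⌜ u ⌝
⌜ plam t ⌝ = lam ⌜ t ⌝

shift : ℕ → ℕ → Tm → Tm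
shift c k (var n) = if n <ᵇ c then var n else var (n + k)
shift c k (app t u) = app (shift c k t) (shift c k u)
shift c k (lam t) = lam (shift (suc c) k t)
shift c k (esub t u) = esub (shift (suc c) k t) (shift c k u)

data LCtx : Set where
  ◻ᴸ   : LCtx
  _[/_]ᴸ : LCtx → Tm → LCtx

plugL : LCtx → Tm → Tm
plugL ◻ᴸ s = s
plugL (L [/ t ]ᴸ) s = esub (plugL L s) t

lenL : LCtx → ℕ
lenL ◻ᴸ = 0
lenL (L [/ t ]ᴸ) = suc (lenL L)

data NCtx : Set where
  ◻ᴺ   : NCtx
  appN : NCtx → Tm → NCtx
  subN : NCtx → Tm → NCtx
  lsN  : NCtx → NCtx → NCtx   -- lsN N M = N⟨⟨x⟩⟩[x/M]

depthN : NCtx → ℕ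
depthN ◻ᴺ = 0
depthN (appN N t) = depthN N
depthN (subN N t) = suc (depthN N)
depthN (lsN N M) = depthN M

-- capturing plug N⟨s⟩
plugN : NCtx → Tm → Tm
plugN ◻ᴺ s = s
plugN (appN N t) s = app (plugN N s) t
plugN (subN N t) s = esub (plugN N s) t
plugN (lsN N M) s = esub (plugN N (var (depthN N))) (plugN M s)

-- N⟨⟨x⟩⟩ where x is the variable bound immediately outside N
plugNvar : NCtx → Tm
plugNvar N = plugN N (var (depthN N))

shiftN : ℕ → ℕ → NCtx → NCtx
shiftN c k ◻ᴺ = ◻ᴺ
shiftN c k (appN N t) = appN (shiftN c k N) (shift c k t)
shiftN c k (subN N t) = subN (shiftN (suc c) k N) (shift c k t)
shiftN c k (lsN N M) = lsN (shiftN (suc c) k N) (shiftN c k M)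

data _↦need_ : Tm → Tm → Set where
  -- L[λx.t] u ↦ L[t[x/u]]
  dB  : ∀ L t u → app (plugL L (lam t)) u ↦need plugL L (esub t (shift 0 (lenL L) u))
  -- N⟨⟨x⟩⟩[x/L[v]] ↦ L[N⟨⟨v⟩⟩[x/v]]   (v = λ b)
  lsv : ∀ N L b →
        esub (plugNvar N) (plugL L (lam b)) ↦need
        plugL L (esub (plugN (shiftN 1 (lenL L) N) (shift 0 (suc (depthN N)) (lam b))) (lam b))

data _→need_ : Tm → Tm → Set where
  need : ∀ N {s s'} → s ↦need s' → plugN N s →need plugN N s'

data Ctx : Set where
  ◻ᶜ    : Ctx
  appLC : Ctx → Tm → Ctx
  appRC : Tm → Ctx → Ctx
  lamC  : Ctx → Ctx
  subLC : Ctx → Tm → Ctx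
  subRC : Tm → Ctx → Ctx

plug : Ctx → Tm → Tm
plug ◻ᶜ s = s
plug (appLC C u) s = app (plug C s) u
plug (appRC t C) s = app t (plug C s)
plug (lamC C) s = lam (plug C s)
plug (subLC C u) s = esub (plug C s) u
plug (subRC t C) s = esub t (plug C s)

ObsEqNeed : Tm → Tm → Set
ObsEqNeed t u = ∀ C → Normalising _→need_ (plug C t) ⇔ Normalising _→need_ (plug C u)

-- Both notions of normalisation coincide with having a weak-head normal form. For →whnd, the
-- weak-head redex is always needed, and by standardisation (Takahashi's parallel-reduction argument)
-- a term with a β-reduct in WHNF reaches one by weak-head reduction. For →need, unfold explicit
-- substitutions: a dB step unfolds to a weak-head step followed by parallel reduction, an lsv step
-- preserves the unfolding and decreases a measure, and call-by-need normal forms unfold to WHNFs.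
-- Finally, reading t[x/u] back as (λx.t)u commutes with plugging, parallel-reduces to the unfolding
-- and is the identity on pure terms, so contexts can be transported between the two languages.

module Submission where

open import Defs
open import Data.Nat using (ℕ; zero; suc; _+_; _∸_; _<ᵇ_; _≡ᵇ_; _<_; s≤s)
open import Data.Nat.Properties using (+-suc; +-identityʳ; +-comm; 1+n≢0; ≤-refl; ≤-trans; m≤m+n; +-monoʳ-<)
open import Data.Bool using (true; false; if_then_else_)
open import Data.List using (List; []; _∷_)
open import Data.List.Properties using (≡-dec)
open import Data.List.Membership.Propositional using (_∈_; lose)
open import Data.List.Membership.Propositional.Properties using (∈-concatMap⁺)
open import Data.List.Relation.Unary.Any using (here)
open import Data.Maybe using (just; nothing)
open import Data.Product using (Σ; _×_; _,_; proj₁; proj₂)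
open import Data.Sum using (_⊎_; inj₁; inj₂)
open import Data.Empty using (⊥-elim)
open import Relation.Nullary using (¬_; yes; no)
open import Relation.Binary.Definitions using (DecidableEquality)
open import Relation.Binary.PropositionalEquality using (_≡_; _≢_; _≗_; refl; sym; trans; cong; cong₂; subst; module ≡-Reasoning)
open import Relation.Binary.Construct.Closure.ReflexiveTransitive using (Star; ε; _◅_; _◅◅_; gmap)
open import Function using (_∘_)
open import Function.Bundles using (_⇔_; mk⇔)
open import Function.Related.Propositional as Related using (SK-sym)

Ren : Set
Ren = ℕ → ℕ

Subst : Set
Subst = ℕ → Λ

ext : Ren → Ren
ext ξ zero = zero
ext ξ (suc n) = suc (ξ n)

ren : Ren → Λ → Λ
ren ξ (pvar n) = pvar (ξ n)
ren ξ (papp t u) = papp (ren ξ t) (ren ξ u)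
ren ξ (plam t) = plam (ren (ext ξ) t)

exts : Subst → Subst
exts σ zero = pvar zero
exts σ (suc n) = ren suc (σ n)

sub : Subst → Λ → Λ
sub σ (pvar n) = σ n
sub σ (papp t u) = papp (sub σ t) (sub σ u)
sub σ (plam t) = plam (sub (exts σ) t)

infixr 5 _•_

_•_ : Λ → Subst → Subst
(v • σ) zero = v
(v • σ) (suc n) = σ n

_⟨_⟩ : Λ → Λ → Λ
t ⟨ v ⟩ = sub (v • pvar) t

ext-cong : ∀ {ξ ζ} → ξ ≗ ζ → ext ξ ≗ ext ζ
ext-cong e zero = refl
ext-cong e (suc n) = cong suc (e n)

ren-cong : ∀ {ξ ζ} → ξ ≗ ζ → ∀ t → ren ξ t ≡ ren ζ t
ren-cong e (pvar n) = cong pvar (e n)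
ren-cong e (papp t u) = cong₂ papp (ren-cong e t) (ren-cong e u)
ren-cong e (plam t) = cong plam (ren-cong (ext-cong e) t)

exts-cong : ∀ {σ τ} → σ ≗ τ → exts σ ≗ exts τ
exts-cong e zero = refl
exts-cong e (suc n) = cong (ren suc) (e n)

sub-cong : ∀ {σ τ} → σ ≗ τ → ∀ t → sub σ t ≡ sub τ t
sub-cong e (pvar n) = e n
sub-cong e (papp t u) = cong₂ papp (sub-cong e t) (sub-cong e u)
sub-cong e (plam t) = cong plam (sub-cong (exts-cong e) t)

•-cong : ∀ {a a' σ σ'} → a ≡ a' → σ ≗ σ' → (a • σ) ≗ (a' • σ')
•-cong e h zero = e
•-cong e h (suc n) = h n

ren-id : ∀ {ξ} → (∀ n → ξ n ≡ n) → ∀ t → ren ξ t ≡ t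
ren-id e (pvar n) = cong pvar (e n)
ren-id e (papp t u) = cong₂ papp (ren-id e t) (ren-id e u)
ren-id {ξ} e (plam t) = cong plam (ren-id ext-id t)
  where ext-id : ∀ n → ext ξ n ≡ n
        ext-id zero = refl
        ext-id (suc n) = cong suc (e n)

sub-id : ∀ t → sub pvar t ≡ t
sub-id (pvar n) = refl
sub-id (papp t u) = cong₂ papp (sub-id t) (sub-id u)
sub-id (plam t) = cong plam (trans (sub-cong exts-id t) (sub-id t))
  where exts-id : exts pvar ≗ pvar
        exts-id zero = refl
        exts-id (suc n) = refl

ren-ren : ∀ ξ ζ t → ren ξ (ren ζ t) ≡ ren (λ n → ξ (ζ n)) t
ren-ren ξ ζ (pvar n) = refl
ren-ren ξ ζ (papp t u) = cong₂ papp (ren-ren ξ ζ t) (ren-ren ξ ζ u)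
ren-ren ξ ζ (plam t) = cong plam (trans (ren-ren (ext ξ) (ext ζ) t) (ren-cong e t))
  where e : (λ n → ext ξ (ext ζ n)) ≗ ext (λ n → ξ (ζ n))
        e zero = refl
        e (suc n) = refl

sub-ren : ∀ σ ξ t → sub σ (ren ξ t) ≡ sub (λ n → σ (ξ n)) t
sub-ren σ ξ (pvar n) = refl
sub-ren σ ξ (papp t u) = cong₂ papp (sub-ren σ ξ t) (sub-ren σ ξ u)
sub-ren σ ξ (plam t) = cong plam (trans (sub-ren (exts σ) (ext ξ) t) (sub-cong e t))
  where e : (λ n → exts σ (ext ξ n)) ≗ exts (λ n → σ (ξ n))
        e zero = refl
        e (suc n) = refl

ren-sub : ∀ ξ σ t → ren ξ (sub σ t) ≡ sub (λ n → ren ξ (σ n)) t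
ren-sub ξ σ (pvar n) = refl
ren-sub ξ σ (papp t u) = cong₂ papp (ren-sub ξ σ t) (ren-sub ξ σ u)
ren-sub ξ σ (plam t) = cong plam (trans (ren-sub (ext ξ) (exts σ) t) (sub-cong e t))
  where e : (λ n → ren (ext ξ) (exts σ n)) ≗ exts (λ n → ren ξ (σ n))
        e zero = refl
        e (suc n) = trans (ren-ren (ext ξ) suc (σ n)) (sym (ren-ren suc ξ (σ n)))

sub-sub : ∀ τ σ t → sub τ (sub σ t) ≡ sub (λ n → sub τ (σ n)) t
sub-sub τ σ (pvar n) = refl
sub-sub τ σ (papp t u) = cong₂ papp (sub-sub τ σ t) (sub-sub τ σ u)
sub-sub τ σ (plam t) = cong plam (trans (sub-sub (exts τ) (exts σ) t) (sub-cong e t))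
  where e : (λ n → sub (exts τ) (exts σ n)) ≗ exts (λ n → sub τ (σ n))
        e zero = refl
        e (suc n) = trans (sub-ren (exts τ) suc (σ n)) (sym (ren-sub suc τ (σ n)))

ren-⟨⟩ : ∀ ξ t v → ren ξ (t ⟨ v ⟩) ≡ (ren (ext ξ) t) ⟨ ren ξ v ⟩
ren-⟨⟩ ξ t v = trans (ren-sub ξ (v • pvar) t) (trans (sub-cong e t) (sym (sub-ren (ren ξ v • pvar) (ext ξ) t)))
  where e : (λ n → ren ξ ((v • pvar) n)) ≗ (λ n → (ren ξ v • pvar) (ext ξ n))
        e zero = refl
        e (suc n) = refl

sub-⟨⟩ : ∀ σ t v → sub σ (t ⟨ v ⟩) ≡ (sub (exts σ) t) ⟨ sub σ v ⟩
sub-⟨⟩ σ t v = trans (sub-sub σ (v • pvar) t) (trans (sub-cong e t) (sym (sub-sub (sub σ v • pvar) (exts σ) t)))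
  where e : (λ n → sub σ ((v • pvar) n)) ≗ (λ n → sub (sub σ v • pvar) (exts σ n))
        e zero = refl
        e (suc n) = trans (sym (sub-id (σ n))) (sym (sub-ren (sub σ v • pvar) suc (σ n)))

exts-⟨⟩ : ∀ σ t v → (sub (exts σ) t) ⟨ v ⟩ ≡ sub (v • σ) t
exts-⟨⟩ σ t v = trans (sub-sub (v • pvar) (exts σ) t) (sub-cong e t)
  where e : (λ n → sub (v • pvar) (exts σ n)) ≗ (v • σ)
        e zero = refl
        e (suc n) = trans (sub-ren (v • pvar) suc (σ n)) (sub-id (σ n))

shiftRen : ℕ → ℕ → Ren
shiftRen c k n = if n <ᵇ c then n else n + k

shiftRen-suc : ∀ c k n → shiftRen (suc c) k (suc n) ≡ suc (shiftRen c k n)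
shiftRen-suc c k n with n <ᵇ c
... | true = refl
... | false = refl

shiftΛ≡ren : ∀ c k t → shiftΛ c k t ≡ ren (shiftRen c k) t
shiftΛ≡ren c k (pvar n) with n <ᵇ c
... | true = refl
... | false = refl
shiftΛ≡ren c k (papp t u) = cong₂ papp (shiftΛ≡ren c k t) (shiftΛ≡ren c k u)
shiftΛ≡ren c k (plam t) = cong plam (trans (shiftΛ≡ren (suc c) k t) (ren-cong e t))
  where e : shiftRen (suc c) k ≗ ext (shiftRen c k)
        e zero = refl
        e (suc n) = shiftRen-suc c k n

ren-suc-shiftΛ : ∀ j v → ren suc (shiftΛ 0 j v) ≡ shiftΛ 0 (suc j) v
ren-suc-shiftΛ j v = trans (cong (ren suc) (shiftΛ≡ren 0 j v)) (trans (ren-ren suc (shiftRen 0 j) v)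
  (trans (ren-cong (λ m → sym (+-suc m j)) v) (sym (shiftΛ≡ren 0 (suc j) v))))

substΛEnv : ℕ → Λ → Subst
substΛEnv j v n = if n ≡ᵇ j then shiftΛ 0 j v else (if n <ᵇ j then pvar n else pvar (n ∸ 1))

substΛ≡sub : ∀ j v t → substΛ j v t ≡ sub (substΛEnv j v) t
substΛ≡sub j v (pvar n) = refl
substΛ≡sub j v (papp t u) = cong₂ papp (substΛ≡sub j v t) (substΛ≡sub j v u)
substΛ≡sub j v (plam t) = cong plam (trans (substΛ≡sub (suc j) v t) (sub-cong (e j) t))
  where
  e : ∀ j → substΛEnv (suc j) v ≗ exts (substΛEnv j v)
  e j zero = refl
  e zero (suc zero) = sym (ren-suc-shiftΛ 0 v)
  e (suc j) (suc zero) = refl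
  e zero (suc (suc n)) = refl
  e (suc j) (suc (suc n)) with n ≡ᵇ j
  ... | true = sym (ren-suc-shiftΛ (suc j) v)
  ... | false with n <ᵇ j
  ...   | true = refl
  ...   | false = refl

[0≔]≡⟨⟩ : ∀ s v → s [0≔ v ] ≡ s ⟨ v ⟩
[0≔]≡⟨⟩ s v = trans (substΛ≡sub 0 v s) (sub-cong e s)
  where e : substΛEnv 0 v ≗ (v • pvar)
        e zero = trans (shiftΛ≡ren 0 0 v) (ren-id +-identityʳ v)
        e (suc n) = refl

-- Parallel reduction and weak-head standardisation

infix 4 _⇒_ _⇒*_ _→wh_ _→wh*_ _⇒ᵢ_

data _⇒_ : Λ → Λ → Set where
  ⇒var : ∀ {n} → pvar n ⇒ pvar n
  ⇒lam : ∀ {t t'} → t ⇒ t' → plam t ⇒ plam t'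
  ⇒app : ∀ {t t' u u'} → t ⇒ t' → u ⇒ u' → papp t u ⇒ papp t' u'
  ⇒β   : ∀ {t t' u u'} → t ⇒ t' → u ⇒ u' → papp (plam t) u ⇒ t' ⟨ u' ⟩

_⇒*_ : Λ → Λ → Set
_⇒*_ = Star _⇒_

par-refl : ∀ t → t ⇒ t
par-refl (pvar n) = ⇒var
par-refl (papp t u) = ⇒app (par-refl t) (par-refl u)
par-refl (plam t) = ⇒lam (par-refl t)

par-ren : ∀ ξ {t t'} → t ⇒ t' → ren ξ t ⇒ ren ξ t'
par-ren ξ ⇒var = ⇒var
par-ren ξ (⇒lam p) = ⇒lam (par-ren (ext ξ) p)
par-ren ξ (⇒app p q) = ⇒app (par-ren ξ p) (par-ren ξ q)
par-ren ξ (⇒β {t' = t'} {u' = u'} p q) =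
  subst (_ ⇒_) (sym (ren-⟨⟩ ξ t' u')) (⇒β (par-ren (ext ξ) p) (par-ren ξ q))

ParSubst : Subst → Subst → Set
ParSubst σ σ' = ∀ n → σ n ⇒ σ' n

par-exts : ∀ {σ σ'} → ParSubst σ σ' → ParSubst (exts σ) (exts σ')
par-exts h zero = ⇒var
par-exts h (suc n) = par-ren suc (h n)

par-• : ∀ {σ σ' v v'} → ParSubst σ σ' → v ⇒ v' → ParSubst (v • σ) (v' • σ')
par-• h p zero = p
par-• h p (suc n) = h n

par-sub : ∀ {σ σ' t t'} → ParSubst σ σ' → t ⇒ t' → sub σ t ⇒ sub σ' t'
par-sub h (⇒var {n}) = h n
par-sub h (⇒lam p) = ⇒lam (par-sub (par-exts h) p)
par-sub h (⇒app p q) = ⇒app (par-sub h p) (par-sub h q)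
par-sub {σ' = σ'} h (⇒β {t' = t'} {u' = u'} p q) =
  subst (_ ⇒_) (sym (sub-⟨⟩ σ' t' u')) (⇒β (par-sub (par-exts h) p) (par-sub h q))

par-⟨⟩ : ∀ {t t' v v'} → t ⇒ t' → v ⇒ v' → t ⟨ v ⟩ ⇒ t' ⟨ v' ⟩
par-⟨⟩ p q = par-sub (par-• (λ n → ⇒var) q) p

data _→wh_ : Λ → Λ → Set where
  whβ   : ∀ {t u} → papp (plam t) u →wh t ⟨ u ⟩
  whapp : ∀ {t t' u} → t →wh t' → papp t u →wh papp t' u

_→wh*_ : Λ → Λ → Set
_→wh*_ = Star _→wh_

wh-deterministic : ∀ {t a b} → t →wh a → t →wh b → a ≡ b
wh-deterministic whβ whβ = refl
wh-deterministic whβ (whapp ())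
wh-deterministic (whapp ()) whβ
wh-deterministic (whapp p) (whapp q) = cong (λ z → papp z _) (wh-deterministic p q)

whnf-wh-irreducible : ∀ {t t'} → WHNF t → ¬ (t →wh t')
whnf-wh-irreducible whnf-lam ()
whnf-wh-irreducible (whnf-ne (ne-app ())) whβ
whnf-wh-irreducible (whnf-ne (ne-app n)) (whapp p) = whnf-wh-irreducible (whnf-ne n) p

whnf-or-wh : ∀ t → WHNF t ⊎ Σ Λ (t →wh_)
whnf-or-wh (pvar n) = inj₁ (whnf-ne ne-var)
whnf-or-wh (plam t) = inj₁ whnf-lam
whnf-or-wh (papp t u) with whnf-or-wh t
... | inj₂ (t' , p) = inj₂ (papp t' u , whapp p)
... | inj₁ whnf-lam = inj₂ (_ , whβ)
... | inj₁ (whnf-ne n) = inj₁ (whnf-ne (ne-app n))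

wh⊆par : ∀ {t t'} → t →wh t' → t ⇒ t'
wh⊆par (whβ {t} {u}) = ⇒β (par-refl t) (par-refl u)
wh⊆par (whapp p) = ⇒app (wh⊆par p) (par-refl _)

par-neutral : ∀ {t t'} → Neutral t → t ⇒ t' → Neutral t'
par-neutral ne-var ⇒var = ne-var
par-neutral (ne-app n) (⇒app p q) = ne-app (par-neutral n p)
par-neutral (ne-app ()) (⇒β p q)

par-whnf : ∀ {t t'} → WHNF t → t ⇒ t' → WHNF t'
par-whnf whnf-lam (⇒lam p) = whnf-lam
par-whnf (whnf-ne n) p = whnf-ne (par-neutral n p)

data WhnfWithin : ℕ → Λ → Set where
  whnf-now  : ∀ {k t} → WHNF t → WhnfWithin k t
  whnf-next : ∀ {k t t'} → t →wh t' → WhnfWithin k t' → WhnfWithin (suc k) t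

whnfWithin-suc : ∀ {k t} → WhnfWithin k t → WhnfWithin (suc k) t
whnfWithin-suc (whnf-now w) = whnf-now w
whnfWithin-suc (whnf-next p h) = whnf-next p (whnfWithin-suc h)

whnfWithin-wh : ∀ {k t u} → WhnfWithin k t → t →wh u → Σ ℕ λ k' → k ≡ suc k' × WhnfWithin k' u
whnfWithin-wh (whnf-now w) p = ⊥-elim (whnf-wh-irreducible w p)
whnfWithin-wh (whnf-next q h) p rewrite wh-deterministic p q = _ , refl , h

wh*-whnfWithin : ∀ {k t t'} → t →wh* t' → WhnfWithin k t' → Σ ℕ λ k' → WhnfWithin k' t
wh*-whnfWithin {k} ε h = k , h
wh*-whnfWithin (p ◅ ps) h with wh*-whnfWithin ps h
... | k' , h' = suc k' , whnf-next p h'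

par-wh-postpone : ∀ {M N M'} → M ⇒ N → M →wh M' →
                  (Σ Λ λ N' → (N →wh N') × (M' ⇒ N')) ⊎ (M' ⇒ N)
par-wh-postpone (⇒app (⇒lam p) q) whβ = inj₁ (_ , whβ , par-⟨⟩ p q)
par-wh-postpone (⇒β p q) whβ = inj₂ (par-⟨⟩ p q)
par-wh-postpone (⇒app p q) (whapp r) with par-wh-postpone p r
... | inj₁ (N' , s , h) = inj₁ (_ , whapp s , ⇒app h q)
... | inj₂ h = inj₂ (⇒app h q)
par-wh-postpone (⇒β p q) (whapp ())

whnfWithin-par : ∀ {k M N} → WhnfWithin k M → M ⇒ N → WhnfWithin k N
whnfWithin-par (whnf-now w) p = whnf-now (par-whnf w p)
whnfWithin-par (whnf-next r h) p with par-wh-postpone p r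
... | inj₁ (N' , s , h') = whnf-next s (whnfWithin-par h h')
... | inj₂ h' = whnfWithin-suc (whnfWithin-par h h')

whnfWithin-par* : ∀ {k M N} → WhnfWithin k M → M ⇒* N → WhnfWithin k N
whnfWithin-par* h ε = h
whnfWithin-par* h (p ◅ ps) = whnfWithin-par* (whnfWithin-par h p) ps

data _⇒ᵢ_ : Λ → Λ → Set where
  ivar : ∀ {n} → pvar n ⇒ᵢ pvar n
  ilam : ∀ {t t'} → t ⇒ t' → plam t ⇒ᵢ plam t'
  iapp : ∀ {t t' u u'} → t ⇒ᵢ t' → u ⇒ u' → papp t u ⇒ᵢ papp t' u'

WhInternalFactorisation : Λ → Λ → Set
WhInternalFactorisation M N = Σ Λ λ L → M →wh* L × L ⇒ᵢ N

-- Generalised to substitutions so that the β case can use the factorisation of the argument.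
sub-par-factorises : ∀ {M N} → M ⇒ N → ∀ {σ σ'} →
  (∀ n → σ n ⇒ σ' n × WhInternalFactorisation (σ n) (σ' n)) →
  sub σ M ⇒ sub σ' N × WhInternalFactorisation (sub σ M) (sub σ' N)
sub-par-factorises (⇒var {n}) h = h n
sub-par-factorises (⇒lam p) h =
  let q = par-sub (par-exts (proj₁ ∘ h)) p in ⇒lam q , _ , ε , ilam q
sub-par-factorises (⇒app {u = u} p q) {σ} h with sub-par-factorises p h
... | p' , L , ws , i = ⇒app p' q' , papp L (sub σ u) , gmap _ whapp ws , iapp i q'
  where q' = par-sub (proj₁ ∘ h) q
sub-par-factorises (⇒β {t} {t'} {u} {u'} p q) {σ} {σ'} h
  with sub-par-factorises q h
... | fq with sub-par-factorises p {sub σ u • σ} {sub σ' u' • σ'} (λ { zero → fq ; (suc n) → h n })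
... | _ , L , ws , i =
  subst (_ ⇒_) (sym (sub-⟨⟩ σ' t' u')) (⇒β (par-sub (par-exts (proj₁ ∘ h)) p) (proj₁ fq)) ,
  L , subst (papp (plam (sub (exts σ) t)) (sub σ u) →wh_) (exts-⟨⟩ σ t (sub σ u)) whβ ◅ ws ,
  subst (L ⇒ᵢ_) (trans (sym (exts-⟨⟩ σ' t' (sub σ' u'))) (sym (sub-⟨⟩ σ' t' u'))) i

par-factorises : ∀ {M N} → M ⇒ N → WhInternalFactorisation M N
par-factorises {M} {N} p with sub-par-factorises p {pvar} {pvar} (λ n → ⇒var , _ , ε , ivar)
... | _ , L , ws , i = L , subst (_→wh* L) (sub-id M) ws , subst (L ⇒ᵢ_) (sub-id N) i

internal-wh-commute : ∀ {L N P} → L ⇒ᵢ N → N →wh P → Σ Λ λ L' → L →wh* L' × L' ⇒ P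
internal-wh-commute (iapp (ilam p) q) whβ = _ , whβ ◅ ε , par-⟨⟩ p q
internal-wh-commute (iapp i q) (whapp r) with internal-wh-commute i r
... | L' , ws , h = _ , gmap _ whapp ws , ⇒app h q

par-wh-commute : ∀ {M N P} → M ⇒ N → N →wh P → Σ Λ λ M' → M →wh* M' × M' ⇒ P
par-wh-commute p r with par-factorises p
... | L , ws , i with internal-wh-commute i r
... | L' , ws' , h = L' , ws ◅◅ ws' , h

internal-neutral⁻¹ : ∀ {L N} → L ⇒ᵢ N → Neutral N → Neutral L
internal-neutral⁻¹ ivar ne-var = ne-var
internal-neutral⁻¹ (iapp i q) (ne-app n) = ne-app (internal-neutral⁻¹ i n)

internal-whnf⁻¹ : ∀ {L N} → L ⇒ᵢ N → WHNF N → WHNF L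
internal-whnf⁻¹ (ilam p) whnf-lam = whnf-lam
internal-whnf⁻¹ i (whnf-ne n) = whnf-ne (internal-neutral⁻¹ i n)

whnfWithin-par⁻¹ : ∀ {k M N} → M ⇒ N → WhnfWithin k N → Σ ℕ λ k' → WhnfWithin k' M
whnfWithin-par⁻¹ p (whnf-now w) with par-factorises p
... | L , ws , i = wh*-whnfWithin ws (whnf-now {0} (internal-whnf⁻¹ i w))
whnfWithin-par⁻¹ p (whnf-next r h) with par-wh-commute p r
... | M' , ws , q with whnfWithin-par⁻¹ q h
... | k' , h' = wh*-whnfWithin ws h'

HasWHNF : Λ → Set
HasWHNF t = Σ Λ λ w → Red t w × WHNF w

step⊆par : ∀ {t r t'} → Step t r t' → t ⇒ t'
step⊆par (β-root {s} {v}) = subst (papp (plam s) v ⇒_) (sym ([0≔]≡⟨⟩ s v)) (⇒β (par-refl s) (par-refl v))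
step⊆par (β-appL p) = ⇒app (step⊆par p) (par-refl _)
step⊆par (β-appR p) = ⇒app (par-refl _) (step⊆par p)
step⊆par (β-lam p) = ⇒lam (step⊆par p)

red-whnfWithin : ∀ {t w} → Red t w → WHNF w → Σ ℕ λ k → WhnfWithin k t
red-whnfWithin done w = 0 , whnf-now w
red-whnfWithin (step s r) w = whnfWithin-par⁻¹ (step⊆par s) (proj₂ (red-whnfWithin r w))

red-++ : ∀ {a b c} → Red a b → Red b c → Red a c
red-++ done r = r
red-++ (step s r) r' = step s (red-++ r r')

red-cong : ∀ (f : Λ → Λ) → (∀ {t r t'} → Step t r t' → Σ Pos λ r' → Step (f t) r' (f t')) →
           ∀ {t t'} → Red t t' → Red (f t) (f t')
red-cong f h done = done
red-cong f h (step s r) = step (proj₂ (h s)) (red-cong f h r)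

red-lam : ∀ {t t'} → Red t t' → Red (plam t) (plam t')
red-lam = red-cong plam (λ s → _ , β-lam s)

red-app : ∀ {t t' u u'} → Red t t' → Red u u' → Red (papp t u) (papp t' u')
red-app {t' = t'} {u = u} p q =
  red-++ (red-cong (λ z → papp z u) (λ s → _ , β-appL s) p) (red-cong (papp t') (λ s → _ , β-appR s) q)

par⊆red : ∀ {t t'} → t ⇒ t' → Red t t'
par⊆red ⇒var = done
par⊆red (⇒lam p) = red-lam (par⊆red p)
par⊆red (⇒app p q) = red-app (par⊆red p) (par⊆red q)
par⊆red (⇒β {t' = t'} {u' = u'} p q) =
  red-++ (red-app (red-lam (par⊆red p)) (par⊆red q))
         (step β-root (subst (Red (t' [0≔ u' ])) ([0≔]≡⟨⟩ t' u') done))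

par*⊆red : ∀ {t t'} → t ⇒* t' → Red t t'
par*⊆red ε = done
par*⊆red (p ◅ ps) = red-++ (par⊆red p) (par*⊆red ps)

whnfWithin-HasWHNF : ∀ {k t} → WhnfWithin k t → HasWHNF t
whnfWithin-HasWHNF (whnf-now w) = _ , done , w
whnfWithin-HasWHNF (whnf-next p h) with whnfWithin-HasWHNF h
... | w , r , x = w , red-++ (par⊆red (wh⊆par p)) r , x

-- The weak-head redex is weak-head needed

data HeadRedexAt : Λ → Pos → Set where
  head-here : ∀ {a b} → HeadRedexAt (papp (plam a) b) []
  head-appL : ∀ {t u p} → HeadRedexAt t p → HeadRedexAt (papp t u) (b0 ∷ p)

headRedex-whnf : ∀ {s p} → HeadRedexAt s p → ¬ WHNF s
headRedex-whnf head-here (whnf-ne (ne-app ()))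
headRedex-whnf (head-appL ()) (whnf-ne (ne-app ne-var))
headRedex-whnf (head-appL h) (whnf-ne (ne-app (ne-app n))) = headRedex-whnf h (whnf-ne (ne-app n))

wh-step-at-head : ∀ {M M'} → M →wh M' → Σ Pos λ p → Step M p M' × HeadRedexAt M p
wh-step-at-head (whβ {t} {u}) = [] , subst (Step (papp (plam t) u) []) ([0≔]≡⟨⟩ t u) β-root , head-here
wh-step-at-head (whapp p) with wh-step-at-head p
... | q , st , h = b0 ∷ q , β-appL st , head-appL h

_≟Bit_ : DecidableEquality Bit
b0 ≟Bit b0 = yes refl
b0 ≟Bit b1 = no λ ()
b1 ≟Bit b0 = no λ ()
b1 ≟Bit b1 = yes refl

step-redex : ∀ {s q s₁} → Step s q s₁ → Σ Λ λ a → Σ Λ λ b → subterm s q ≡ just (papp (plam a) b)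
step-redex β-root = _ , _ , refl
step-redex (β-appL st) = step-redex st
step-redex (β-appR st) = step-redex st
step-redex (β-lam st) = step-redex st

-- Contracting any other redex leaves the head redex in place, as its own unique descendant.
headRedex-step : ∀ {s q s₁ p} → Step s q s₁ → HeadRedexAt s p → q ≢ p →
                 HeadRedexAt s₁ p × stripPrefix q p ≡ nothing
headRedex-step β-root head-here q≢p = ⊥-elim (q≢p refl)
headRedex-step (β-appL (β-lam st)) head-here q≢p = head-here , refl
headRedex-step (β-appR st) head-here q≢p = head-here , refl
headRedex-step (β-appL st) (head-appL h) q≢p with headRedex-step st h (q≢p ∘ cong (b0 ∷_))
... | h' , e = head-appL h' , e
headRedex-step (β-appR st) (head-appL h) q≢p = head-appL h , refl

headRedex-needed : ∀ {s p R t} → HeadRedexAt s p → p ∈ R → (red : Red s t) → WHNF t → Uses red R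
headRedex-needed h p∈R done w = ⊥-elim (headRedex-whnf h w)
headRedex-needed {s} {p} {R} h p∈R (step {r = q} st red) w with ≡-dec _≟Bit_ q p
... | yes refl = now p∈R
... | no q≢p with headRedex-step st h q≢p | step-redex st
... | h' , e | a , b , e' = later (headRedex-needed h' p∈resid red w)
  where
  p∈resid : p ∈ resid s q R
  p∈resid rewrite e' = ∈-concatMap⁺ (desc a q) (lose p∈R (subst (λ z → p ∈ descAux a q p z) (sym e) (here refl)))

wh⊆whnd : ∀ {M M'} → M →wh M' → M →whnd M'
wh⊆whnd p with wh-step-at-head p
... | q , st , h = q , st , (_ , st) , λ t' red w → headRedex-needed h (here refl) red w

whnf-whnd-normal : ∀ {M M'} → WHNF M → ¬ (M →whnd M')
whnf-whnd-normal {M} w (_ , _ , _ , needed) with needed M done w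
... | ()

whnfWithin-whnd-normalising : ∀ {k M} → WhnfWithin k M → Normalising _→whnd_ M
whnfWithin-whnd-normalising {M = M} (whnf-now w) = M , ε , λ _ → whnf-whnd-normal w
whnfWithin-whnd-normalising (whnf-next p h) with whnfWithin-whnd-normalising h
... | w , st , nf = w , wh⊆whnd p ◅ st , nf

whnd*⊆red : ∀ {a b} → Star _→whnd_ a b → Red a b
whnd*⊆red ε = done
whnd*⊆red ((r , st , _) ◅ ss) = step st (whnd*⊆red ss)

whnd-normalising⇔HasWHNF : ∀ M → Normalising _→whnd_ M ⇔ HasWHNF M
whnd-normalising⇔HasWHNF M = mk⇔ to from
  where
  to : Normalising _→whnd_ M → HasWHNF M
  to (w , ss , nf) with whnf-or-wh w
  ... | inj₁ x = w , whnd*⊆red ss , x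
  ... | inj₂ (w' , p) = ⊥-elim (nf w' (wh⊆whnd p))
  from : HasWHNF M → Normalising _→whnd_ M
  from (w , r , x) = whnfWithin-whnd-normalising (proj₂ (red-whnfWithin r x))

-- Unfolding explicit substitutions

unfold : Tm → Subst → Λ
unfold (var n) ρ = ρ n
unfold (app a b) ρ = papp (unfold a ρ) (unfold b ρ)
unfold (lam a) ρ = plam (unfold a (exts ρ))
unfold (esub a b) ρ = unfold a (unfold b ρ • ρ)

unfold-cong : ∀ {ρ ρ'} → ρ ≗ ρ' → ∀ t → unfold t ρ ≡ unfold t ρ'
unfold-cong h (var n) = h n
unfold-cong h (app a b) = cong₂ papp (unfold-cong h a) (unfold-cong h b)
unfold-cong h (lam a) = cong plam (unfold-cong (exts-cong h) a)
unfold-cong h (esub a b) = unfold-cong (•-cong (unfold-cong h b) h) a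

unfold-shift : ∀ c k t ρ → unfold (shift c k t) ρ ≡ unfold t (ρ ∘ shiftRen c k)
unfold-shift c k (var n) ρ with n <ᵇ c
... | true = refl
... | false = refl
unfold-shift c k (app a b) ρ = cong₂ papp (unfold-shift c k a ρ) (unfold-shift c k b ρ)
unfold-shift c k (lam a) ρ = cong plam (trans (unfold-shift (suc c) k a (exts ρ)) (unfold-cong e a))
  where e : exts ρ ∘ shiftRen (suc c) k ≗ exts (ρ ∘ shiftRen c k)
        e zero = refl
        e (suc n) = cong (exts ρ) (shiftRen-suc c k n)
unfold-shift c k (esub a b) ρ = trans (unfold-shift (suc c) k a _) (unfold-cong e a)
  where e : (unfold (shift c k b) ρ • ρ) ∘ shiftRen (suc c) k ≗ (unfold b (ρ ∘ shiftRen c k) • ρ ∘ shiftRen c k)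
        e zero = unfold-shift c k b ρ
        e (suc n) = cong (unfold (shift c k b) ρ • ρ) (shiftRen-suc c k n)

sub-unfold : ∀ τ t ρ → sub τ (unfold t ρ) ≡ unfold t (sub τ ∘ ρ)
sub-unfold τ (var n) ρ = refl
sub-unfold τ (app a b) ρ = cong₂ papp (sub-unfold τ a ρ) (sub-unfold τ b ρ)
sub-unfold τ (lam a) ρ = cong plam (trans (sub-unfold (exts τ) a (exts ρ)) (unfold-cong e a))
  where e : sub (exts τ) ∘ exts ρ ≗ exts (sub τ ∘ ρ)
        e zero = refl
        e (suc n) = trans (sub-ren (exts τ) suc (ρ n)) (sym (ren-sub suc τ (ρ n)))
sub-unfold τ (esub a b) ρ = trans (sub-unfold τ a _) (unfold-cong e a)
  where e : sub τ ∘ (unfold b ρ • ρ) ≗ (unfold b (sub τ ∘ ρ) • sub τ ∘ ρ)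
        e zero = sub-unfold τ b ρ
        e (suc n) = refl

unfold-⟨⟩ : ∀ a ρ v → (unfold a (exts ρ)) ⟨ v ⟩ ≡ unfold a (v • ρ)
unfold-⟨⟩ a ρ v = trans (sub-unfold (v • pvar) a (exts ρ)) (unfold-cong e a)
  where e : sub (v • pvar) ∘ exts ρ ≗ (v • ρ)
        e zero = refl
        e (suc n) = trans (sub-ren (v • pvar) suc (ρ n)) (sub-id (ρ n))

listEnv : LCtx → Subst → Subst
listEnv ◻ᴸ ρ = ρ
listEnv (L [/ t ]ᴸ) ρ = listEnv L (unfold t ρ • ρ)

unfold-plugL : ∀ L s ρ → unfold (plugL L s) ρ ≡ unfold s (listEnv L ρ)
unfold-plugL ◻ᴸ s ρ = refl
unfold-plugL (L [/ t ]ᴸ) s ρ = unfold-plugL L s (unfold t ρ • ρ)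

listEnv-+lenL : ∀ L ρ n → listEnv L ρ (n + lenL L) ≡ ρ n
listEnv-+lenL ◻ᴸ ρ n = cong ρ (+-identityʳ n)
listEnv-+lenL (L [/ t ]ᴸ) ρ n =
  trans (cong (listEnv L (unfold t ρ • ρ)) (+-suc n (lenL L))) (listEnv-+lenL L _ (suc n))

par*-app : ∀ {a a' b b'} → a ⇒* a' → b ⇒* b' → papp a b ⇒* papp a' b'
par*-app {a' = a'} {b = b} p q = gmap (λ z → papp z b) (λ r → ⇒app r (par-refl b)) p
                        ◅◅ gmap (papp a') (⇒app (par-refl a')) q

ParSubst* : Subst → Subst → Set
ParSubst* ρ ρ' = ∀ n → ρ n ⇒* ρ' n

par*-• : ∀ {a a' ρ ρ'} → ParSubst* ρ ρ' → a ⇒* a' → ParSubst* (a • ρ) (a' • ρ')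
par*-• h p zero = p
par*-• h p (suc n) = h n

par*-exts : ∀ {ρ ρ'} → ParSubst* ρ ρ' → ParSubst* (exts ρ) (exts ρ')
par*-exts h zero = ε
par*-exts h (suc n) = gmap (ren suc) (par-ren suc) (h n)

unfold-par* : ∀ t {ρ ρ'} → ParSubst* ρ ρ' → unfold t ρ ⇒* unfold t ρ'
unfold-par* (var n) h = h n
unfold-par* (app a b) h = par*-app (unfold-par* a h) (unfold-par* b h)
unfold-par* (lam a) h = gmap plam ⇒lam (unfold-par* a (par*-exts h))
unfold-par* (esub a b) h = unfold-par* a (par*-• h (unfold-par* b h))

listEnv-par* : ∀ L {ρ ρ'} → ParSubst* ρ ρ' → ParSubst* (listEnv L ρ) (listEnv L ρ')
listEnv-par* ◻ᴸ h = h
listEnv-par* (L [/ t ]ᴸ) h = listEnv-par* L (par*-• h (unfold-par* t h))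

WhThenPar* : Λ → Λ → Set
WhThenPar* x y = Σ Λ λ w → x →wh w × w ⇒* y

whThenPar*-app : ∀ {x y b b'} → WhThenPar* x y → b ⇒* b' → WhThenPar* (papp x b) (papp y b')
whThenPar*-app (w , st , ps) q = papp w _ , whapp st , par*-app ps q

WhSimulated : Tm → Tm → Set
WhSimulated s s' = ∀ ρ ρ' → ParSubst* ρ ρ' → WhThenPar* (unfold s ρ) (unfold s' ρ')

dB-simulated : ∀ L t u → WhSimulated (app (plugL L (lam t)) u) (plugL L (esub t (shift 0 (lenL L) u)))
dB-simulated L t u ρ ρ' h =
  unfold t (unfold u ρ • E) ,
  subst (λ z → papp z (unfold u ρ) →wh unfold t (unfold u ρ • E)) (sym (unfold-plugL L (lam t) ρ))
    (subst (papp (plam (unfold t (exts E))) (unfold u ρ) →wh_) (unfold-⟨⟩ t E (unfold u ρ)) whβ) ,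
  subst (_ ⇒*_) unfold-contractum (unfold-par* t (par*-• (listEnv-par* L h) (unfold-par* u h)))
  where
  E = listEnv L ρ
  unfold-contractum : unfold t (unfold u ρ' • listEnv L ρ') ≡ unfold (plugL L (esub t (shift 0 (lenL L) u))) ρ'
  unfold-contractum = sym (trans (unfold-plugL L _ ρ') (unfold-cong (•-cong (trans (unfold-shift 0 (lenL L) u _)
    (unfold-cong (listEnv-+lenL L ρ') u)) λ _ → refl) t))

-- A weak-head step of the value bound to the variable a need context points at is a weak-head
-- step of the whole unfolding, since that variable unfolds in head position.
plugN-var-simulated : ∀ N j n → n ≡ depthN N + j → ∀ ρ ρ' → ParSubst* ρ ρ' →
  WhThenPar* (ρ j) (ρ' j) → WhThenPar* (unfold (plugN N (var n)) ρ) (unfold (plugN N (var n)) ρ')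
plugN-var-simulated ◻ᴺ j n refl ρ ρ' h sim = sim
plugN-var-simulated (appN N t) j n e ρ ρ' h sim =
  whThenPar*-app (plugN-var-simulated N j n e ρ ρ' h sim) (unfold-par* t h)
plugN-var-simulated (subN N t) j n e ρ ρ' h sim =
  plugN-var-simulated N (suc j) n (trans e (sym (+-suc (depthN N) j))) _ _ (par*-• h (unfold-par* t h)) sim
plugN-var-simulated (lsN N M) j n e ρ ρ' h sim =
  plugN-var-simulated N 0 (depthN N) (sym (+-identityʳ _)) _ _
    (par*-• h (unfold-par* (plugN M (var n)) h)) (plugN-var-simulated M j n e ρ ρ' h sim)

plugN-simulated : ∀ N {s s'} → WhSimulated s s' → WhSimulated (plugN N s) (plugN N s')
plugN-simulated ◻ᴺ h = h
plugN-simulated (appN N t) h ρ ρ' P = whThenPar*-app (plugN-simulated N h ρ ρ' P) (unfold-par* t P)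
plugN-simulated (subN N t) h ρ ρ' P = plugN-simulated N h _ _ (par*-• P (unfold-par* t P))
plugN-simulated (lsN N M) h ρ ρ' P with plugN-simulated M h ρ ρ' P
... | sim@(a , st , ps) =
  plugN-var-simulated N 0 (depthN N) (sym (+-identityʳ _)) _ _ (par*-• P (wh⊆par st ◅ ps)) sim

plugN-unfold-cong : ∀ N {s s'} → (∀ ρ → unfold s ρ ≡ unfold s' ρ) →
                    ∀ ρ → unfold (plugN N s) ρ ≡ unfold (plugN N s') ρ
plugN-unfold-cong ◻ᴺ h ρ = h ρ
plugN-unfold-cong (appN N t) h ρ = cong (λ z → papp z (unfold t ρ)) (plugN-unfold-cong N h ρ)
plugN-unfold-cong (subN N t) h ρ = plugN-unfold-cong N h (unfold t ρ • ρ)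
plugN-unfold-cong (lsN N M) h ρ = unfold-cong (•-cong (plugN-unfold-cong M h ρ) λ _ → refl) (plugNvar N)

depthN-shiftN : ∀ c k N → depthN (shiftN c k N) ≡ depthN N
depthN-shiftN c k ◻ᴺ = refl
depthN-shiftN c k (appN N t) = depthN-shiftN c k N
depthN-shiftN c k (subN N t) = cong suc (depthN-shiftN (suc c) k N)
depthN-shiftN c k (lsN N M) = depthN-shiftN c k M

FillersAgree : ℕ → ℕ → ℕ → Subst → Subst → Tm → Tm → Set
FillersAgree d c k ρ₁ ρ₂ X Y = ∀ ρ₁' ρ₂' → ρ₁' ∘ shiftRen (d + c) k ≗ ρ₂' →
  ρ₁' ∘ (d +_) ≗ ρ₁ → ρ₂' ∘ (d +_) ≗ ρ₂ → unfold X ρ₁' ≡ unfold Y ρ₂'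

fillersAgree-suc : ∀ d c k ρ₁ ρ₂ a₁ a₂ X Y → FillersAgree (suc d) c k ρ₁ ρ₂ X Y →
                   FillersAgree d (suc c) k (a₁ • ρ₁) (a₂ • ρ₂) X Y
fillersAgree-suc d c k ρ₁ ρ₂ a₁ a₂ X Y agree ρ₁' ρ₂' r e₁ e₂ =
  agree ρ₁' ρ₂' (λ i → trans (cong (λ z → ρ₁' (shiftRen z k i)) (sym (+-suc d c))) (r i))
    (λ i → trans (cong ρ₁' (sym (+-suc d i))) (e₁ (suc i)))
    (λ i → trans (cong ρ₂' (sym (+-suc d i))) (e₂ (suc i)))

shift-•-agree : ∀ c k {ρ₁ ρ₂ a₁ a₂} → ρ₁ ∘ shiftRen c k ≗ ρ₂ → a₁ ≡ a₂ →
                (a₁ • ρ₁) ∘ shiftRen (suc c) k ≗ (a₂ • ρ₂)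
shift-•-agree c k r e zero = e
shift-•-agree c k {ρ₁} {a₁ = a₁} r e (suc i) = trans (cong (a₁ • ρ₁) (shiftRen-suc c k i)) (r i)

unfold-plugN-shiftN : ∀ N c k ρ₁ ρ₂ X Y → ρ₁ ∘ shiftRen c k ≗ ρ₂ → FillersAgree (depthN N) c k ρ₁ ρ₂ X Y →
                      unfold (plugN (shiftN c k N) X) ρ₁ ≡ unfold (plugN N Y) ρ₂
unfold-plugN-shiftN ◻ᴺ c k ρ₁ ρ₂ X Y r agree = agree ρ₁ ρ₂ r (λ _ → refl) (λ _ → refl)
unfold-plugN-shiftN (appN N t) c k ρ₁ ρ₂ X Y r agree =
  cong₂ papp (unfold-plugN-shiftN N c k ρ₁ ρ₂ X Y r agree) (trans (unfold-shift c k t ρ₁) (unfold-cong r t))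
unfold-plugN-shiftN (subN N t) c k ρ₁ ρ₂ X Y r agree =
  unfold-plugN-shiftN N (suc c) k _ _ X Y
    (shift-•-agree c k r (trans (unfold-shift c k t ρ₁) (unfold-cong r t)))
    (fillersAgree-suc (depthN N) c k ρ₁ ρ₂ _ _ X Y agree)
unfold-plugN-shiftN (lsN N M) c k ρ₁ ρ₂ X Y r agree rewrite depthN-shiftN (suc c) k N =
  unfold-plugN-shiftN N (suc c) k _ _ (var (depthN N)) (var (depthN N)) (shift-•-agree c k r eM) agree-var
  where
  eM : unfold (plugN (shiftN c k M) X) ρ₁ ≡ unfold (plugN M Y) ρ₂
  eM = unfold-plugN-shiftN M c k ρ₁ ρ₂ X Y r agree
  d = depthN N
  agree-var : FillersAgree d (suc c) k (_ • ρ₁) (_ • ρ₂) (var d) (var d)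
  agree-var ρ₁' ρ₂' r₁ e₁ e₂ =
    trans (cong ρ₁' (sym (+-identityʳ d))) (trans (e₁ 0) (trans eM (trans (sym (e₂ 0)) (cong ρ₂' (+-identityʳ d)))))

lsv-unfold : ∀ N L b ρ → unfold (esub (plugNvar N) (plugL L (lam b))) ρ ≡
  unfold (plugL L (esub (plugN (shiftN 1 (lenL L) N) (shift 0 (suc (depthN N)) (lam b))) (lam b))) ρ
lsv-unfold N L b ρ = begin
  unfold (plugNvar N) (unfold (plugL L (lam b)) ρ • ρ) ≡⟨ unfold-cong (•-cong (unfold-plugL L (lam b) ρ) λ _ → refl) (plugNvar N) ⟩
  unfold (plugN N (var d)) (V • ρ)                    ≡⟨ unfold-plugN-shiftN N 1 (lenL L) (V • E) (V • ρ) X (var d) shifted agree ⟨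
  unfold (plugN (shiftN 1 (lenL L) N) X) (V • E)      ≡⟨ unfold-plugL L (esub (plugN (shiftN 1 (lenL L) N) X) (lam b)) ρ ⟨
  unfold (plugL L (esub (plugN (shiftN 1 (lenL L) N) X) (lam b))) ρ ∎
  where
  open ≡-Reasoning
  d = depthN N
  E = listEnv L ρ
  V = unfold (lam b) E
  X = shift 0 (suc d) (lam b)
  shifted : (V • E) ∘ shiftRen 1 (lenL L) ≗ (V • ρ)
  shifted = shift-•-agree 0 (lenL L) (listEnv-+lenL L ρ) refl
  agree : FillersAgree d 1 (lenL L) (V • E) (V • ρ) X (var d)
  agree ρ₁' ρ₂' r₁ e₁ e₂ = begin
    unfold X ρ₁'                                ≡⟨ unfold-shift 0 (suc d) (lam b) ρ₁' ⟩
    unfold (lam b) (ρ₁' ∘ shiftRen 0 (suc d))   ≡⟨ unfold-cong (λ n → trans (cong ρ₁' (n+1+d≡d+1+n n)) (e₁ (suc n))) (lam b) ⟩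
    V                                           ≡⟨ e₂ 0 ⟨
    ρ₂' (d + 0)                                 ≡⟨ cong ρ₂' (+-identityʳ d) ⟩
    ρ₂' d                                       ∎
    where n+1+d≡d+1+n : ∀ n → n + suc d ≡ d + suc n
          n+1+d≡d+1+n n = trans (+-comm n (suc d)) (sym (+-suc d n))

-- Call-by-need normal forms

data Answer : Tm → Set where
  answer-lam  : ∀ {t} → Answer (lam t)
  answer-esub : ∀ {a b} → Answer a → Answer (esub a b)

data NeutralAt : ℕ → Tm → Set where
  neutral-var  : ∀ {j} → NeutralAt j (var j)
  neutral-app  : ∀ {j a b} → NeutralAt j a → NeutralAt j (app a b)
  neutral-esub : ∀ {j a b} → NeutralAt (suc j) a → NeutralAt j (esub a b)
  neutral-ls   : ∀ {j a b} → NeutralAt 0 a → NeutralAt j b → NeutralAt j (esub a b)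

answer-plugL : ∀ {s} → Answer s → Σ LCtx λ L → Σ Tm λ t → s ≡ plugL L (lam t)
answer-plugL answer-lam = ◻ᴸ , _ , refl
answer-plugL (answer-esub {b = b} h) with answer-plugL h
... | L , t , refl = L [/ b ]ᴸ , t , refl

neutralAt-plugN : ∀ {j s} → NeutralAt j s → Σ NCtx λ N → s ≡ plugN N (var (depthN N + j))
neutralAt-plugN neutral-var = ◻ᴺ , refl
neutralAt-plugN (neutral-app {b = b} h) with neutralAt-plugN h
... | N , refl = appN N b , refl
neutralAt-plugN {j} (neutral-esub {b = b} h) with neutralAt-plugN h
... | N , refl = subN N b , cong (λ z → esub (plugN N (var z)) b) (+-suc (depthN N) j)
neutralAt-plugN (neutral-ls h₁ h₂) with neutralAt-plugN h₁ | neutralAt-plugN h₂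
... | N , refl | M , refl =
  lsN N M , cong (λ z → esub (plugN N (var z)) (plugN M (var (depthN M + _)))) (+-identityʳ (depthN N))

unfold-answer : ∀ {s} → Answer s → ∀ ρ → WHNF (unfold s ρ)
unfold-answer answer-lam ρ = whnf-lam
unfold-answer (answer-esub {b = b} h) ρ = unfold-answer h (unfold b ρ • ρ)

unfold-neutralAt : ∀ {j s} → NeutralAt j s → ∀ ρ → Neutral (ρ j) → Neutral (unfold s ρ)
unfold-neutralAt neutral-var ρ n = n
unfold-neutralAt (neutral-app h) ρ n = ne-app (unfold-neutralAt h ρ n)
unfold-neutralAt (neutral-esub {b = b} h) ρ n = unfold-neutralAt h (unfold b ρ • ρ) n
unfold-neutralAt (neutral-ls {b = b} h₁ h₂) ρ n = unfold-neutralAt h₁ (unfold b ρ • ρ) (unfold-neutralAt h₂ ρ n)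

need-progress : ∀ s → Answer s ⊎ (Σ ℕ λ j → NeutralAt j s) ⊎ Σ Tm (s →need_)
need-progress (var n) = inj₂ (inj₁ (n , neutral-var))
need-progress (lam t) = inj₁ answer-lam
need-progress (app a b) with need-progress a
... | inj₁ h with answer-plugL h
...   | L , t , refl = inj₂ (inj₂ (_ , need ◻ᴺ (dB L t b)))
need-progress (app a b) | inj₂ (inj₁ (j , h)) = inj₂ (inj₁ (j , neutral-app h))
need-progress (app a b) | inj₂ (inj₂ (s' , need N r)) = inj₂ (inj₂ (_ , need (appN N b) r))
need-progress (esub a b) with need-progress a
... | inj₁ h = inj₁ (answer-esub h)
... | inj₂ (inj₂ (s' , need N r)) = inj₂ (inj₂ (_ , need (subN N b) r))
... | inj₂ (inj₁ (suc j , h)) = inj₂ (inj₁ (j , neutral-esub h))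
... | inj₂ (inj₁ (zero , h)) with neutralAt-plugN h | need-progress b
...   | N , e | inj₁ hb with answer-plugL hb
...     | L , t , refl rewrite e | +-identityʳ (depthN N) = inj₂ (inj₂ (_ , need ◻ᴺ (lsv N L t)))
need-progress (esub a b) | inj₂ (inj₁ (zero , h)) | N , e | inj₂ (inj₁ (j , hb)) =
  inj₂ (inj₁ (j , neutral-ls h hb))
need-progress (esub a b) | inj₂ (inj₁ (zero , h)) | N , e | inj₂ (inj₂ (s' , need M r))
  rewrite e | +-identityʳ (depthN N) = inj₂ (inj₂ (_ , need (lsN N M) r))

¬answer-plugN-var : ∀ N n → ¬ Answer (plugN N (var n))
¬answer-plugN-var ◻ᴺ n ()
¬answer-plugN-var (appN N t) n ()
¬answer-plugN-var (subN N t) n (answer-esub h) = ¬answer-plugN-var N n h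
¬answer-plugN-var (lsN N M) n (answer-esub h) = ¬answer-plugN-var N _ h

¬neutralAt-plugL-lam : ∀ L t j → ¬ NeutralAt j (plugL L (lam t))
¬neutralAt-plugL-lam ◻ᴸ t j ()
¬neutralAt-plugL-lam (L [/ u ]ᴸ) t j (neutral-esub h) = ¬neutralAt-plugL-lam L t _ h
¬neutralAt-plugL-lam (L [/ u ]ᴸ) t j (neutral-ls h _) = ¬neutralAt-plugL-lam L t _ h

neutralAt-plugN-var-unique : ∀ N n i k → n ≡ depthN N + k → NeutralAt i (plugN N (var n)) → i ≡ k
neutralAt-plugN-var-unique ◻ᴺ n i k e neutral-var = e
neutralAt-plugN-var-unique (appN N t) n i k e (neutral-app h) = neutralAt-plugN-var-unique N n i k e h
neutralAt-plugN-var-unique (subN N t) n i k e (neutral-esub h) =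
  cong (_∸ 1) (neutralAt-plugN-var-unique N n (suc i) (suc k) (trans e (sym (+-suc (depthN N) k))) h)
neutralAt-plugN-var-unique (subN N t) n i k e (neutral-ls h _) =
  ⊥-elim (1+n≢0 (sym (neutralAt-plugN-var-unique N n 0 (suc k) (trans e (sym (+-suc (depthN N) k))) h)))
neutralAt-plugN-var-unique (lsN N M) n i k e (neutral-esub h) =
  ⊥-elim (1+n≢0 (neutralAt-plugN-var-unique N _ (suc i) 0 (sym (+-identityʳ _)) h))
neutralAt-plugN-var-unique (lsN N M) n i k e (neutral-ls _ h) = neutralAt-plugN-var-unique M n i k e h

¬neutralAt-suc-plugNvar : ∀ N j → ¬ NeutralAt (suc j) (plugNvar N)
¬neutralAt-suc-plugNvar N j h = 1+n≢0 (neutralAt-plugN-var-unique N _ (suc j) 0 (sym (+-identityʳ _)) h)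

Reducible : Tm → Set
Reducible r = ¬ Answer r × (∀ j → ¬ NeutralAt j r)

↦need-reducible : ∀ {r r'} → r ↦need r' → Reducible r
↦need-reducible (dB L t u) = (λ ()) , λ { j (neutral-app h) → ¬neutralAt-plugL-lam L t j h }
↦need-reducible (lsv N L b) =
  (λ { (answer-esub h) → ¬answer-plugN-var N _ h }) ,
  λ { j (neutral-esub h) → ¬neutralAt-suc-plugNvar N j h
    ; j (neutral-ls _ h) → ¬neutralAt-plugL-lam L b j h }

plugN-reducible : ∀ N {r} → Reducible r → Reducible (plugN N r)
plugN-reducible ◻ᴺ h = h
plugN-reducible (appN N t) h = (λ ()) , λ { j (neutral-app x) → proj₂ (plugN-reducible N h) j x }
plugN-reducible (subN N t) h =
  (λ { (answer-esub x) → proj₁ (plugN-reducible N h) x }) ,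
  λ { j (neutral-esub x) → proj₂ (plugN-reducible N h) (suc j) x
    ; j (neutral-ls x _) → proj₂ (plugN-reducible N h) 0 x }
plugN-reducible (lsN N M) h =
  (λ { (answer-esub x) → ¬answer-plugN-var N _ x }) ,
  λ { j (neutral-esub x) → ¬neutralAt-suc-plugNvar N j x
    ; j (neutral-ls _ x) → proj₂ (plugN-reducible M h) j x }

→need-reducible : ∀ {s s'} → s →need s' → Reducible s
→need-reducible (need N r) = plugN-reducible N (↦need-reducible r)

-- Termination measure for substitution steps

data Shape : Set where
  value other : Shape
  waiting : ℕ → Shape

data Settled : Shape → Set where
  settled-value : Settled value
  settled-other : Settled other

shape-app : Shape × ℕ → Shape × ℕ
shape-app (waiting n , c) = waiting n , c
shape-app (_ , c) = other , c

shape-esub : Shape × ℕ → Shape × ℕ → Shape × ℕ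
shape-esub (value , c) _ = value , c
shape-esub (other , c) _ = other , c
shape-esub (waiting (suc n) , c) _ = waiting n , c
shape-esub (waiting zero , c) (waiting n , c') = waiting n , suc (c + c')
shape-esub (waiting zero , c) (_ , c') = other , suc (c + c')

-- The count is the number of N⟨⟨x⟩⟩[x/M] layers met while searching for the redex of a need step:
-- a [x/L[v]] step deletes one of them and leaves the rest.
headShape : Tm → Shape × ℕ
headShape (var n) = waiting n , 0
headShape (lam t) = value , 0
headShape (app a b) = shape-app (headShape a)
headShape (esub a b) = shape-esub (headShape a) (headShape b)

μ : Tm → ℕ
μ s = proj₂ (headShape s)

lsLayers : NCtx → ℕ
lsLayers ◻ᴺ = 0
lsLayers (appN N t) = lsLayers N
lsLayers (subN N t) = lsLayers N
lsLayers (lsN N M) = suc (lsLayers N + lsLayers M)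

lsLayers-shiftN : ∀ c k N → lsLayers (shiftN c k N) ≡ lsLayers N
lsLayers-shiftN c k ◻ᴺ = refl
lsLayers-shiftN c k (appN N t) = lsLayers-shiftN c k N
lsLayers-shiftN c k (subN N t) = lsLayers-shiftN (suc c) k N
lsLayers-shiftN c k (lsN N M) = cong₂ (λ a b → suc (a + b)) (lsLayers-shiftN (suc c) k N) (lsLayers-shiftN c k M)

headShape-plugN-var : ∀ N j n → n ≡ depthN N + j → headShape (plugN N (var n)) ≡ (waiting j , lsLayers N)
headShape-plugN-var ◻ᴺ j n refl = refl
headShape-plugN-var (appN N t) j n e rewrite headShape-plugN-var N j n e = refl
headShape-plugN-var (subN N t) j n e rewrite headShape-plugN-var N (suc j) n (trans e (sym (+-suc (depthN N) j))) = refl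
headShape-plugN-var (lsN N M) j n e
  rewrite headShape-plugN-var N 0 (depthN N) (sym (+-identityʳ _)) | headShape-plugN-var M j n e = refl

headShape-plugNvar : ∀ N → headShape (plugNvar N) ≡ (waiting 0 , lsLayers N)
headShape-plugNvar N = headShape-plugN-var N 0 (depthN N) (sym (+-identityʳ _))

headShape-plugN-lam : ∀ N b → Σ Shape λ g → Settled g × headShape (plugN N (lam b)) ≡ (g , lsLayers N)
headShape-plugN-lam ◻ᴺ b = value , settled-value , refl
headShape-plugN-lam (appN N t) b with headShape-plugN-lam N b
... | _ , settled-value , e rewrite e = other , settled-other , refl
... | _ , settled-other , e rewrite e = other , settled-other , refl
headShape-plugN-lam (subN N t) b with headShape-plugN-lam N b
... | _ , settled-value , e rewrite e = value , settled-value , refl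
... | _ , settled-other , e rewrite e = other , settled-other , refl
headShape-plugN-lam (lsN N M) b with headShape-plugN-lam M b
... | _ , settled-value , e rewrite headShape-plugNvar N | e = other , settled-other , refl
... | _ , settled-other , e rewrite headShape-plugNvar N | e = other , settled-other , refl

headShape-esub-settled : ∀ X Y {g c} → Settled g → headShape X ≡ (g , c) → headShape (esub X Y) ≡ (g , c)
headShape-esub-settled X Y settled-value e rewrite e = refl
headShape-esub-settled X Y settled-other e rewrite e = refl

headShape-plugL : ∀ L X {g c} → Settled g → headShape X ≡ (g , c) → headShape (plugL L X) ≡ (g , c)
headShape-plugL ◻ᴸ X G e = e
headShape-plugL (L [/ t ]ᴸ) X G e = headShape-esub-settled (plugL L X) t G (headShape-plugL L X G e)

data ShapeDecrease (r r' : Tm) : Set where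
  shape-decrease : ∀ c c' g → headShape r ≡ (other , c) → Settled g → headShape r' ≡ (g , c') → c' < c →
                   ShapeDecrease r r'

lsv-shapeDecrease : ∀ N L b → ShapeDecrease (esub (plugNvar N) (plugL L (lam b)))
  (plugL L (esub (plugN (shiftN 1 (lenL L) N) (shift 0 (suc (depthN N)) (lam b))) (lam b)))
lsv-shapeDecrease N L b with headShape-plugN-lam (shiftN 1 (lenL L) N) (shift 1 (suc (depthN N)) b)
... | g , G , e = shape-decrease (suc (lsLayers N + 0)) (lsLayers N) g before G
  (headShape-plugL L _ G after) (s≤s (m≤m+n (lsLayers N) 0))
  where
  before : headShape (esub (plugNvar N) (plugL L (lam b))) ≡ (other , suc (lsLayers N + 0))
  before rewrite headShape-plugNvar N | headShape-plugL L (lam b) settled-value refl = refl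
  substituted = plugN (shiftN 1 (lenL L) N) (shift 0 (suc (depthN N)) (lam b))
  after : headShape (esub substituted (lam b)) ≡ (g , lsLayers N)
  after = trans (headShape-esub-settled substituted (lam b) G e) (cong (g ,_) (lsLayers-shiftN 1 (lenL L) N))

plugN-shapeDecrease : ∀ N {r r'} → ShapeDecrease r r' → ShapeDecrease (plugN N r) (plugN N r')
plugN-shapeDecrease ◻ᴺ h = h
plugN-shapeDecrease (appN N t) h with plugN-shapeDecrease N h
... | shape-decrease c c' g e G e' lt =
  shape-decrease c c' other (cong shape-app e) settled-other (trans (cong shape-app e') (settled-app G)) lt
  where settled-app : ∀ {g c'} → Settled g → shape-app (g , c') ≡ (other , c')
        settled-app settled-value = refl
        settled-app settled-other = refl
plugN-shapeDecrease (subN N t) {r} {r'} h with plugN-shapeDecrease N h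
... | shape-decrease c c' g e G e' lt =
  shape-decrease c c' g (headShape-esub-settled (plugN N r) t settled-other e) G
                 (headShape-esub-settled (plugN N r') t G e') lt
plugN-shapeDecrease (lsN N M) {r} {r'} h with plugN-shapeDecrease M h
... | shape-decrease c c' g e G e' lt =
  shape-decrease _ _ other (esub-waiting (plugN M r) settled-other e) settled-other (esub-waiting (plugN M r') G e')
    (s≤s (+-monoʳ-< (lsLayers N) lt))
  where
  esub-waiting : ∀ X {g c} → Settled g → headShape X ≡ (g , c) →
                 headShape (esub (plugNvar N) X) ≡ (other , suc (lsLayers N + c))
  esub-waiting X settled-value e rewrite headShape-plugNvar N | e = refl
  esub-waiting X settled-other e rewrite headShape-plugNvar N | e = refl

shapeDecrease-μ : ∀ {r r'} → ShapeDecrease r r' → μ r' < μ r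
shapeDecrease-μ (shape-decrease c c' g e G e' lt) rewrite e | e' = lt

need-step-unfold : ∀ {s s'} → s →need s' →
  WhThenPar* (unfold s pvar) (unfold s' pvar) ⊎ (unfold s pvar ≡ unfold s' pvar × μ s' < μ s)
need-step-unfold (need N (dB L t u)) = inj₁ (plugN-simulated N (dB-simulated L t u) pvar pvar λ _ → ε)
need-step-unfold (need N (lsv N' L b)) =
  inj₂ (plugN-unfold-cong N (lsv-unfold N' L b) pvar ,
        shapeDecrease-μ (plugN-shapeDecrease N (lsv-shapeDecrease N' L b)))

need*-red : ∀ {s t} → Star _→need_ s t → Red (unfold s pvar) (unfold t pvar)
need*-red ε = done
need*-red (st ◅ ss) with need-step-unfold st
... | inj₁ (w , sw , ps) = red-++ (par⊆red (wh⊆par sw)) (red-++ (par*⊆red ps) (need*-red ss))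
... | inj₂ (e , _) = subst (λ z → Red z _) (sym e) (need*-red ss)

-- Recursion on (k, n) lexicographically: dB steps consume a weak-head step of the unfolding, lsv steps decrease μ.
need-normalising-within : ∀ k n s → WhnfWithin k (unfold s pvar) → μ s < n → Normalising _→need_ s
need-normalising-within k (suc n) s h (s≤s μs≤n) with need-progress s
... | inj₁ a = s , ε , λ s'' st → proj₁ (→need-reducible st) a
... | inj₂ (inj₁ (j , x)) = s , ε , λ s'' st → proj₂ (→need-reducible st) j x
... | inj₂ (inj₂ (s' , st)) with need-step-unfold st
...   | inj₂ (e , μs'<μs) with need-normalising-within k n s' (subst (WhnfWithin k) e h) (≤-trans μs'<μs μs≤n)
...     | t , ss , nf = t , st ◅ ss , nf
need-normalising-within k (suc n) s h _ | inj₂ (inj₂ (s' , st)) | inj₁ (w , sw , ps)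
  with whnfWithin-wh h sw
... | k' , refl , h' with need-normalising-within k' (suc (μ s')) s' (whnfWithin-par* h' ps) ≤-refl
...   | t , ss , nf = t , st ◅ ss , nf

need-normalising⇔HasWHNF : ∀ s → Normalising _→need_ s ⇔ HasWHNF (unfold s pvar)
need-normalising⇔HasWHNF s = mk⇔ to from
  where
  to : Normalising _→need_ s → HasWHNF (unfold s pvar)
  to (t , ss , nf) with need-progress t
  ... | inj₁ a = _ , need*-red ss , unfold-answer a pvar
  ... | inj₂ (inj₁ (j , h)) = _ , need*-red ss , whnf-ne (unfold-neutralAt h pvar ne-var)
  ... | inj₂ (inj₂ (s' , st)) = ⊥-elim (nf s' st)
  from : HasWHNF (unfold s pvar) → Normalising _→need_ s
  from (w , r , x) = need-normalising-within _ (suc (μ s)) s (proj₂ (red-whnfWithin r x)) ≤-refl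

-- Read-back of explicit substitutions as β-redexes

readBack : Tm → Λ
readBack (var n) = pvar n
readBack (app a b) = papp (readBack a) (readBack b)
readBack (lam a) = plam (readBack a)
readBack (esub a b) = papp (plam (readBack a)) (readBack b)

sub-readBack-par : ∀ s {ρ ρ'} → ParSubst ρ ρ' → sub ρ (readBack s) ⇒ unfold s ρ'
sub-readBack-par (var n) h = h n
sub-readBack-par (app a b) h = ⇒app (sub-readBack-par a h) (sub-readBack-par b h)
sub-readBack-par (lam a) h = ⇒lam (sub-readBack-par a (par-exts h))
sub-readBack-par (esub a b) {ρ' = ρ'} h =
  subst (_ ⇒_) (unfold-⟨⟩ a ρ' (unfold b ρ')) (⇒β (sub-readBack-par a (par-exts h)) (sub-readBack-par b h))

readBack-par-unfold : ∀ s → readBack s ⇒ unfold s pvar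
readBack-par-unfold s = subst (_⇒ unfold s pvar) (sub-id (readBack s)) (sub-readBack-par s λ _ → ⇒var)

HasWHNF-unfold⇔readBack : ∀ s → HasWHNF (unfold s pvar) ⇔ HasWHNF (readBack s)
HasWHNF-unfold⇔readBack s = mk⇔
  (λ (w , r , x) → w , red-++ (par⊆red (readBack-par-unfold s)) r , x)
  (λ (w , r , x) → whnfWithin-HasWHNF (whnfWithin-par (proj₂ (red-whnfWithin r x)) (readBack-par-unfold s)))

readBackCtx : Ctx → PCtx
readBackCtx ◻ᶜ = ◻
readBackCtx (appLC C u) = pappL (readBackCtx C) (readBack u)
readBackCtx (appRC t C) = pappR (readBack t) (readBackCtx C)
readBackCtx (lamC C) = plamC (readBackCtx C)
readBackCtx (subLC C u) = pappL (plamC (readBackCtx C)) (readBack u)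
readBackCtx (subRC t C) = pappR (plam (readBack t)) (readBackCtx C)

⌜_⌝ᶜ : PCtx → Ctx
⌜ ◻ ⌝ᶜ = ◻ᶜ
⌜ pappL C u ⌝ᶜ = appLC ⌜ C ⌝ᶜ ⌜ u ⌝
⌜ pappR t C ⌝ᶜ = appRC ⌜ t ⌝ ⌜ C ⌝ᶜ
⌜ plamC C ⌝ᶜ = lamC ⌜ C ⌝ᶜ

readBack-⌜⌝ : ∀ t → readBack ⌜ t ⌝ ≡ t
readBack-⌜⌝ (pvar n) = refl
readBack-⌜⌝ (papp t u) = cong₂ papp (readBack-⌜⌝ t) (readBack-⌜⌝ u)
readBack-⌜⌝ (plam t) = cong plam (readBack-⌜⌝ t)

readBackCtx-⌜⌝ᶜ : ∀ C → readBackCtx ⌜ C ⌝ᶜ ≡ C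
readBackCtx-⌜⌝ᶜ ◻ = refl
readBackCtx-⌜⌝ᶜ (pappL C u) = cong₂ pappL (readBackCtx-⌜⌝ᶜ C) (readBack-⌜⌝ u)
readBackCtx-⌜⌝ᶜ (pappR t C) = cong₂ pappR (readBack-⌜⌝ t) (readBackCtx-⌜⌝ᶜ C)
readBackCtx-⌜⌝ᶜ (plamC C) = cong plamC (readBackCtx-⌜⌝ᶜ C)

readBack-plug : ∀ C s → readBack (plug C s) ≡ plugP (readBackCtx C) (readBack s)
readBack-plug ◻ᶜ s = refl
readBack-plug (appLC C u) s = cong (λ z → papp z (readBack u)) (readBack-plug C s)
readBack-plug (appRC t C) s = cong (papp (readBack t)) (readBack-plug C s)
readBack-plug (lamC C) s = cong plam (readBack-plug C s)
readBack-plug (subLC C u) s = cong (λ z → papp (plam z) (readBack u)) (readBack-plug C s)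
readBack-plug (subRC t C) s = cong (papp (plam (readBack t))) (readBack-plug C s)

plug-need⇔whnd : ∀ C t → Normalising _→need_ (plug C ⌜ t ⌝) ⇔ Normalising _→whnd_ (plugP (readBackCtx C) t)
plug-need⇔whnd C t = begin
  Normalising _→need_ (plug C ⌜ t ⌝)              ∼⟨ need-normalising⇔HasWHNF (plug C ⌜ t ⌝) ⟩
  HasWHNF (unfold (plug C ⌜ t ⌝) pvar)            ∼⟨ HasWHNF-unfold⇔readBack (plug C ⌜ t ⌝) ⟩
  HasWHNF (readBack (plug C ⌜ t ⌝))               ≡⟨ cong HasWHNF (readBack-plug C ⌜ t ⌝) ⟩
  HasWHNF (plugP (readBackCtx C) (readBack ⌜ t ⌝)) ≡⟨ cong (HasWHNF ∘ plugP (readBackCtx C)) (readBack-⌜⌝ t) ⟩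
  HasWHNF (plugP (readBackCtx C) t)               ∼⟨ SK-sym (whnd-normalising⇔HasWHNF (plugP (readBackCtx C) t)) ⟩
  Normalising _→whnd_ (plugP (readBackCtx C) t)   ∎
  where open Related.EquationalReasoning

mainTheorem1 : (t u : Λ) → ObsEqWhnd t u ⇔ ObsEqNeed ⌜ t ⌝ ⌜ u ⌝
mainTheorem1 t u = mk⇔ whnd⇒need need⇒whnd
  where
  open Related.EquationalReasoning
  whnd⇒need : ObsEqWhnd t u → ObsEqNeed ⌜ t ⌝ ⌜ u ⌝
  whnd⇒need obs C = begin
    Normalising _→need_ (plug C ⌜ t ⌝)             ∼⟨ plug-need⇔whnd C t ⟩
    Normalising _→whnd_ (plugP (readBackCtx C) t)  ∼⟨ obs (readBackCtx C) ⟩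
    Normalising _→whnd_ (plugP (readBackCtx C) u)  ∼⟨ SK-sym (plug-need⇔whnd C u) ⟩
    Normalising _→need_ (plug C ⌜ u ⌝)             ∎
  need⇒whnd : ObsEqNeed ⌜ t ⌝ ⌜ u ⌝ → ObsEqWhnd t u
  need⇒whnd obs C = begin
    Normalising _→whnd_ (plugP C t)                     ≡⟨ cong (normalising-plugP t) (readBackCtx-⌜⌝ᶜ C) ⟨
    Normalising _→whnd_ (plugP (readBackCtx ⌜ C ⌝ᶜ) t)  ∼⟨ SK-sym (plug-need⇔whnd ⌜ C ⌝ᶜ t) ⟩
    Normalising _→need_ (plug ⌜ C ⌝ᶜ ⌜ t ⌝)             ∼⟨ obs ⌜ C ⌝ᶜ ⟩
    Normalising _→need_ (plug ⌜ C ⌝ᶜ ⌜ u ⌝)             ∼⟨ plug-need⇔whnd ⌜ C ⌝ᶜ u ⟩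
    Normalising _→whnd_ (plugP (readBackCtx ⌜ C ⌝ᶜ) u)  ≡⟨ cong (normalising-plugP u) (readBackCtx-⌜⌝ᶜ C) ⟩
    Normalising _→whnd_ (plugP C u)                     ∎
    where normalising-plugP : Λ → PCtx → Set
          normalising-plugP s D = Normalising _→whnd_ (plugP D s)
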